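{- Let $\mathcal{P},\mathcal{Q}$ be partitions of the same nonempty finite set. If $\mathcal{Q}\prec_\delta\mathcal{P}$, then there exist $P\in\mathcal{P}$ and a set $Q$ that is a union of members of $\mathcal{Q}$ such that $|P\triangle Q|\le3\delta|P|$.
   Context: For sets $S,T$, $S\subseteq_\beta T$ means $|S\setminus T|\le\beta|S|$; $S\in_\beta\mathcal{P}$ means $S\subseteq_\beta P$ for some $P\in\mathcal{P}$; for partitions of the same set of size $n$, $\mathcal{Q}\prec_\beta\mathcal{P}$ means $\sum_{Q\in\mathcal{Q}:\,Q\notin_\beta\mathcal{P}}|Q|\le\beta n$.
   Formalization: The parameter δ ranges over the rationals. -}

module Defs where

open import Data.Nat using (ℕ; suc)
open import Data.Nat.ListAction using (sum)
open import Data.Integer using (+_)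
open import Data.Rational using (ℚ; _/_; _*_; _≤_)
open import Data.Rational.Properties using (_≤?_)
open import Data.Fin using (Fin)
open import Data.Fin.Properties using (any?)
open import Data.Fin.Subset using (Subset; _∪_; _─_; ∣_∣)
open import Data.Vec using (tabulate; lookup)
open import Data.List using (List)
import Data.List as List
open import Data.Product using (∃; _,_)
open import Relation.Binary.PropositionalEquality using (_≡_)
open import Relation.Nullary using (Dec; yes; no; ¬_)
open import Relation.Nullary.Decidable using (⌊_⌋)
open import Data.Fin using (_≟_)

ℕ→ℚ : ℕ → ℚ
ℕ→ℚ m = (+ m) / 1

-- A partition of the ground set Fin n into k nonempty blocks, encoded by
-- a labelling  label : Fin n → Fin k ; block i = label⁻¹(i), nonempty by surjectivity.
record Partition (n : ℕ) : Set where
  field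
    k        : ℕ
    label    : Fin n → Fin k
    nonempty : ∀ (i : Fin k) → ∃ λ x → label x ≡ i
open Partition public

block : ∀ {n} (𝒫 : Partition n) → Fin (k 𝒫) → Subset n
block 𝒫 i = tabulate (λ x → ⌊ label 𝒫 x ≟ i ⌋)

_⊆[_]_ : ∀ {n} → Subset n → ℚ → Subset n → Set
S ⊆[ β ] T = ℕ→ℚ ∣ S ─ T ∣ ≤ β * ℕ→ℚ ∣ S ∣

_⊆[_]?_ : ∀ {n} (S : Subset n) (β : ℚ) (T : Subset n) → Dec (S ⊆[ β ] T)
S ⊆[ β ]? T = ℕ→ℚ ∣ S ─ T ∣ ≤? β * ℕ→ℚ ∣ S ∣

_∈[_]_ : ∀ {n} → Subset n → ℚ → Partition n → Set
S ∈[ β ] 𝒫 = ∃ λ (i : Fin (k 𝒫)) → S ⊆[ β ] block 𝒫 i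

_∈[_]?_ : ∀ {n} (S : Subset n) (β : ℚ) (𝒫 : Partition n) → Dec (S ∈[ β ] 𝒫)
S ∈[ β ]? 𝒫 = any? (λ i → S ⊆[ β ]? block 𝒫 i)

badMass : ∀ {n} → Partition n → ℚ → Partition n → ℕ
badMass 𝒬 β 𝒫 = sum (List.tabulate λ j → term (block 𝒬 j))
  where
  term : _ → ℕ
  term Q with Q ∈[ β ]? 𝒫
  ... | yes _ = 0
  ... | no  _ = ∣ Q ∣

_≺[_]_ : ∀ {n} → Partition n → ℚ → Partition n → Set
_≺[_]_ {n} 𝒬 β 𝒫 = ℕ→ℚ (badMass 𝒬 β 𝒫) ≤ β * ℕ→ℚ n

unionOf : ∀ {n} (𝒬 : Partition n) → Subset (k 𝒬) → Subset n
unionOf 𝒬 J = tabulate (λ x → lookup J (label 𝒬 x))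

_△_ : ∀ {n} → Subset n → Subset n → Subset n
S △ T = (S ─ T) ∪ (T ─ S)

module Submission where

-- Assign every block Q ∈ 𝒬 with Q ⊆_δ P for some P ∈ 𝒫 to such a P, and let U_P be
-- the union of the blocks assigned to P.  Counting element by element, an element x lies in
-- no set P △ U_P when its 𝒬-block is assigned to its own 𝒫-block, in exactly one when its
-- 𝒬-block is unassigned, and in at most two otherwise.  The unassigned elements are exactly
-- those counted by the bad mass (≤ δn by hypothesis), and the misplaced elements of an
-- assigned block Q number at most δ|Q|, hence at most δn in total.  So
--   Σ_P |P △ U_P| ≤ δn + 2δn = Σ_P 3δ|P|,
-- and averaging over the (nonempty) set of blocks gives the required P.  The hypothesis also
-- forces δ ≥ 0, which the bound on misplaced elements needs.

open import Defs
open import Data.Nat as ℕ using (ℕ; zero; suc; _≥_)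
import Data.Nat.Properties as ℕP
open import Data.Nat.Coprimality using (Coprime; 1-coprimeTo)
import Data.Nat.Coprimality as Coprimality
open import Data.Nat.ListAction using (sum)
open import Data.Integer as ℤ using (+_)
import Data.Integer.Properties as ℤP
open import Data.Rational as ℚ using (ℚ; mkℚ; _/_; 0ℚ; 1ℚ; _+_; _*_; _≤_; _<_)
import Data.Rational.Properties as ℚP
open import Data.Bool using (Bool; true; false; not; _∧_; _∨_; _xor_)
open import Data.Bool.Properties using (∧-identityʳ; ∧-zeroʳ; xor-identityʳ; xor-same)
open import Data.Fin using (Fin; _≟_)
import Data.Fin as F
open import Data.Fin.Properties using (any?)
open import Data.Fin.Subset using (Subset; ∣_∣; _─_; inside; outside)
open import Data.Vec using ([]; _∷_; lookup; tabulate)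
open import Data.Vec.Properties using (lookup∘tabulate; lookup-zipWith)
import Data.List as List
import Data.List.Properties as ListP
open import Data.Maybe using (Maybe; just; nothing; is-nothing)
open import Data.Product using (∃; ∃₂; _,_)
open import Data.Empty using (⊥-elim)
open import Function using (_∘_)
open import Relation.Binary.PropositionalEquality hiding (J)
open import Relation.Nullary using (Dec; yes; no)
open import Relation.Nullary.Decidable using (⌊_⌋)
open import Algebra.Bundles using (CommutativeRing)
import Algebra.Properties.Semiring.Sum as SemiringSum

open SemiringSum ℕP.+-*-semiring
  using (sum-syntax; ∑-comm; ∑-distrib-+; sum-replicate-zero; sum-cong-≗; *-distribˡ-sum)

𝟙 : Bool → ℕ
𝟙 true  = 1
𝟙 false = 0

∑-mono-≤ : ∀ {m} {f g : Fin m → ℕ} → (∀ i → f i ℕ.≤ g i) → ∑[ i < m ] f i ℕ.≤ ∑[ i < m ] g i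
∑-mono-≤ {zero}  f≤g = ℕ.z≤n
∑-mono-≤ {suc m} f≤g = ℕP.+-mono-≤ (f≤g F.zero) (∑-mono-≤ (f≤g ∘ F.suc))

∑-ones : ∀ n → ∑[ x < n ] 1 ≡ n
∑-ones zero    = refl
∑-ones (suc n) = cong suc (∑-ones n)

∑-point : ∀ m (y : Fin m) (g : Fin m → Bool) → ∑[ j < m ] 𝟙 (⌊ y ≟ j ⌋ ∧ g j) ≡ 𝟙 (g y)
∑-point (suc m) F.zero    g =
  trans (cong (𝟙 (g F.zero) ℕ.+_) (sum-replicate-zero m)) (ℕP.+-identityʳ (𝟙 (g F.zero)))
∑-point (suc m) (F.suc y) g =
  trans (sum-cong-≗ (λ j → cong (λ b → 𝟙 (b ∧ g (F.suc j))) (suc≟suc y j))) (∑-point m y (g ∘ F.suc))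
  where
  suc≟suc : ∀ {m} (y j : Fin m) → ⌊ F.suc y ≟ F.suc j ⌋ ≡ ⌊ y ≟ j ⌋
  suc≟suc y j with y ≟ j
  ... | yes _ = refl
  ... | no  _ = refl

∑-≟ : ∀ m (y : Fin m) → ∑[ j < m ] 𝟙 ⌊ y ≟ j ⌋ ≡ 1
∑-≟ m y = trans (sum-cong-≗ (λ j → cong 𝟙 (sym (∧-identityʳ ⌊ y ≟ j ⌋)))) (∑-point m y (λ _ → true))

∑-fibres : ∀ {n m} (ℓ : Fin n → Fin m) (g : Fin m → Fin n → Bool) →
           ∑[ j < m ] ∑[ x < n ] 𝟙 (⌊ ℓ x ≟ j ⌋ ∧ g j x) ≡ ∑[ x < n ] 𝟙 (g (ℓ x) x)
∑-fibres {m = m} ℓ g =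
  trans (∑-comm (λ j x → 𝟙 (⌊ ℓ x ≟ j ⌋ ∧ g j x))) (sum-cong-≗ (λ x → ∑-point m (ℓ x) (λ j → g j x)))

∣∣-as-∑ : ∀ {n} (p : Subset n) → ∣ p ∣ ≡ ∑[ x < n ] 𝟙 (lookup p x)
∣∣-as-∑ []            = refl
∣∣-as-∑ (inside  ∷ p) = cong suc (∣∣-as-∑ p)
∣∣-as-∑ (outside ∷ p) = ∣∣-as-∑ p

lookup-─ : ∀ {n} (p q : Subset n) x → lookup (p ─ q) x ≡ lookup p x ∧ not (lookup q x)
lookup-─ (a ∷ p) (inside  ∷ q) F.zero    = sym (∧-zeroʳ a)
lookup-─ (a ∷ p) (outside ∷ q) F.zero    = sym (∧-identityʳ a)
lookup-─ (a ∷ p) (b       ∷ q) (F.suc x) = lookup-─ p q x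

lookup-△ : ∀ {n} (p q : Subset n) x → lookup (p △ q) x ≡ lookup p x xor lookup q x
lookup-△ p q x = begin
  lookup (p △ q) x                                    ≡⟨ lookup-zipWith _∨_ x (p ─ q) (q ─ p) ⟩
  lookup (p ─ q) x ∨ lookup (q ─ p) x                 ≡⟨ cong₂ _∨_ (lookup-─ p q x) (lookup-─ q p x) ⟩
  (a ∧ not b) ∨ (b ∧ not a)                           ≡⟨ xor-as-∨ a b ⟩
  a xor b                                             ∎
  where
  open ≡-Reasoning
  a = lookup p x
  b = lookup q x
  xor-as-∨ : ∀ a b → (a ∧ not b) ∨ (b ∧ not a) ≡ a xor b
  xor-as-∨ true  true  = refl
  xor-as-∨ true  false = refl
  xor-as-∨ false true  = refl
  xor-as-∨ false false = refl

∣block∣-as-∑ : ∀ {n} (𝒫 : Partition n) i → ∣ block 𝒫 i ∣ ≡ ∑[ x < n ] 𝟙 ⌊ label 𝒫 x ≟ i ⌋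
∣block∣-as-∑ {n} 𝒫 i = trans (∣∣-as-∑ (block 𝒫 i)) (sum-cong-≗ {n} (λ x → cong 𝟙 (lookup∘tabulate _ x)))

∑-block-∧ : ∀ {n} (𝒫 : Partition n) i b →
            ∑[ x < n ] 𝟙 (⌊ label 𝒫 x ≟ i ⌋ ∧ b) ≡ 𝟙 b ℕ.* ∣ block 𝒫 i ∣
∑-block-∧ {n} 𝒫 i true  = trans (sum-cong-≗ {n} (λ x → cong 𝟙 (∧-identityʳ ⌊ label 𝒫 x ≟ i ⌋)))
                               (sym (trans (ℕP.*-identityˡ _) (∣block∣-as-∑ 𝒫 i)))
∑-block-∧ {n} 𝒫 i false = trans (sum-cong-≗ {n} (λ x → cong 𝟙 (∧-zeroʳ ⌊ label 𝒫 x ≟ i ⌋))) (sum-replicate-zero n)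

∑-block-sizes : ∀ {n} (𝒫 : Partition n) → ∑[ i < k 𝒫 ] ∣ block 𝒫 i ∣ ≡ n
∑-block-sizes {n} 𝒫 = begin
  ∑[ i < k 𝒫 ] ∣ block 𝒫 i ∣                                  ≡⟨ sum-cong-≗ {k 𝒫} (λ i → sym (one-block i)) ⟩
  ∑[ i < k 𝒫 ] ∑[ x < n ] 𝟙 (⌊ label 𝒫 x ≟ i ⌋ ∧ true)        ≡⟨ ∑-fibres (label 𝒫) (λ _ _ → true) ⟩
  ∑[ x < n ] 1                                                ≡⟨ ∑-ones n ⟩
  n                                                           ∎
  where
  open ≡-Reasoning
  one-block : ∀ i → ∑[ x < n ] 𝟙 (⌊ label 𝒫 x ≟ i ⌋ ∧ true) ≡ ∣ block 𝒫 i ∣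
  one-block i = trans (∑-block-∧ 𝒫 i true) (ℕP.*-identityˡ _)

∣Q─P∣-as-∑ : ∀ {n} (𝒬 𝒫 : Partition n) j c →
             ∣ block 𝒬 j ─ block 𝒫 c ∣ ≡ ∑[ x < n ] 𝟙 (⌊ label 𝒬 x ≟ j ⌋ ∧ not ⌊ label 𝒫 x ≟ c ⌋)
∣Q─P∣-as-∑ {n} 𝒬 𝒫 j c = trans (∣∣-as-∑ (block 𝒬 j ─ block 𝒫 c)) (sum-cong-≗ {n} (λ x → cong 𝟙
  (trans (lookup-─ (block 𝒬 j) (block 𝒫 c) x)
         (cong₂ (λ a b → a ∧ not b) (lookup∘tabulate _ x) (lookup∘tabulate _ x)))))

badSize : ∀ {n} (Q : Subset n) (β : ℚ) (𝒫 : Partition n) → Dec (Q ∈[ β ] 𝒫) → ℕ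
badSize Q β 𝒫 (yes _) = 0
badSize Q β 𝒫 (no  _) = ∣ Q ∣

sum-tabulate : ∀ {m} (f : Fin m → ℕ) → sum (List.tabulate f) ≡ ∑[ j < m ] f j
sum-tabulate {zero}  f = refl
sum-tabulate {suc m} f = cong (f F.zero ℕ.+_) (sum-tabulate (f ∘ F.suc))

-- Its summand in Defs is a local with-function that
-- cannot be named from outside, so the left side of badMass-summand is inferred from the
-- single use in badMass-as-∑ (hence the mutual block); case analysis on the decision then
-- makes both sides compute.
mutual
  badMass-as-∑ : ∀ {n} (𝒬 𝒫 : Partition n) β →
                 badMass 𝒬 β 𝒫 ≡ ∑[ j < k 𝒬 ] badSize (block 𝒬 j) β 𝒫 (block 𝒬 j ∈[ β ]? 𝒫)
  badMass-as-∑ 𝒬 𝒫 β = trans (cong sum (ListP.tabulate-cong (badMass-summand 𝒬 𝒫 β)))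
                              (sum-tabulate (λ j → badSize (block 𝒬 j) β 𝒫 (block 𝒬 j ∈[ β ]? 𝒫)))

  badMass-summand : ∀ {n} (𝒬 𝒫 : Partition n) β j → _ ≡ badSize (block 𝒬 j) β 𝒫 (block 𝒬 j ∈[ β ]? 𝒫)
  badMass-summand 𝒬 𝒫 β j with block 𝒬 j ∈[ β ]? 𝒫
  ... | yes _ = refl
  ... | no  _ = refl

module ℚΣ = SemiringSum (CommutativeRing.semiring ℚP.+-*-commutativeRing)

coprime-1 : ∀ m → Coprime m 1
coprime-1 m = Coprimality.sym (1-coprimeTo m)

ℕ→ℚ-as-mkℚ : ∀ m → ℕ→ℚ m ≡ mkℚ (+ m) 0 (coprime-1 m)
ℕ→ℚ-as-mkℚ m = ℚP.normalize-coprime (coprime-1 m)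

ℕ→ℚ-+ : ∀ a b → ℕ→ℚ (a ℕ.+ b) ≡ ℕ→ℚ a + ℕ→ℚ b
ℕ→ℚ-+ a b = begin
  ℕ→ℚ (a ℕ.+ b)                                          ≡⟨ cong (λ z → z / 1) numerators ⟩
  mkℚ (+ a) 0 (coprime-1 a) + mkℚ (+ b) 0 (coprime-1 b)  ≡⟨ sym (cong₂ _+_ (ℕ→ℚ-as-mkℚ a) (ℕ→ℚ-as-mkℚ b)) ⟩
  ℕ→ℚ a + ℕ→ℚ b                                          ∎
  where
  open ≡-Reasoning
  numerators : + (a ℕ.+ b) ≡ + a ℤ.* + 1 ℤ.+ + b ℤ.* + 1
  numerators = trans (ℤP.pos-+ a b) (sym (cong₂ ℤ._+_ (ℤP.*-identityʳ (+ a)) (ℤP.*-identityʳ (+ b))))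

ℕ→ℚ-mono : ∀ {a b} → a ℕ.≤ b → ℕ→ℚ a ≤ ℕ→ℚ b
ℕ→ℚ-mono {a} {b} a≤b = subst₂ _≤_ (sym (ℕ→ℚ-as-mkℚ a)) (sym (ℕ→ℚ-as-mkℚ b))
  (ℚ.*≤* (subst₂ ℤ._≤_ (sym (ℤP.*-identityʳ (+ a))) (sym (ℤP.*-identityʳ (+ b))) (ℤ.+≤+ a≤b)))

ℕ→ℚ-∑ : ∀ {m} (f : Fin m → ℕ) → ℕ→ℚ (∑[ i < m ] f i) ≡ ℚΣ.sum (λ i → ℕ→ℚ (f i))
ℕ→ℚ-∑ {zero}  f = refl
ℕ→ℚ-∑ {suc m} f = trans (ℕ→ℚ-+ (f F.zero) _) (cong (λ s → ℕ→ℚ (f F.zero) + s) (ℕ→ℚ-∑ (f ∘ F.suc)))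

0≤ℕ→ℚ : ∀ m → 0ℚ ≤ ℕ→ℚ m
0≤ℕ→ℚ m = ℕ→ℚ-mono {0} {m} ℕ.z≤n

*-nonNeg : ∀ {a b} → 0ℚ ≤ a → 0ℚ ≤ b → 0ℚ ≤ a * b
*-nonNeg {a} {b} 0≤a 0≤b = ℚP.nonNegative⁻¹ (a * b)
  {{ℚP.nonNeg*nonNeg⇒nonNeg a {{ℚ.nonNegative 0≤a}} b {{ℚ.nonNegative 0≤b}}}}

ℕ→ℚ-pos : ∀ {m} → m ≥ 1 → 0ℚ < ℕ→ℚ m
ℕ→ℚ-pos {m} m≥1 = ℚP.<-≤-trans (ℚP.positive⁻¹ 1ℚ) (ℕ→ℚ-mono {1} {m} m≥1)

nonNeg-factor : ∀ {a δ c} → 0ℚ ≤ a → a ≤ δ * c → 0ℚ < c → 0ℚ ≤ δ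
nonNeg-factor {a} {δ} {c} 0≤a a≤δc 0<c with 0ℚ ℚP.≤? δ
... | yes 0≤δ = 0≤δ
... | no  0≰δ = ⊥-elim (ℚP.<-irrefl refl (ℚP.≤-<-trans 0≤a (ℚP.≤-<-trans a≤δc δc<0)))
  where
  δc<0 : δ * c < 0ℚ
  δc<0 = subst (δ * c <_) (ℚP.*-zeroʳ δ) (ℚP.*-monoʳ-<-neg δ {{ℚ.negative (ℚP.≰⇒> 0≰δ)}} 0<c)

thrice : ∀ a b → (+ 3) / 1 * a * b ≡ a * b + (a * b + a * b)
thrice a b = begin
  (+ 3) / 1 * a * b              ≡⟨ ℚP.*-assoc ((+ 3) / 1) a b ⟩
  (1ℚ + (1ℚ + 1ℚ)) * ab          ≡⟨ ℚP.*-distribʳ-+ ab 1ℚ (1ℚ + 1ℚ) ⟩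
  1ℚ * ab + (1ℚ + 1ℚ) * ab       ≡⟨ cong (λ s → 1ℚ * ab + s) (ℚP.*-distribʳ-+ ab 1ℚ 1ℚ) ⟩
  1ℚ * ab + (1ℚ * ab + 1ℚ * ab)  ≡⟨ cong (λ y → y + (y + y)) (ℚP.*-identityˡ ab) ⟩
  ab + (ab + ab)                 ∎
  where
  open ≡-Reasoning
  ab = a * b

ℚΣ-mono-≤ : ∀ {m} {f g : Fin m → ℚ} → (∀ i → f i ≤ g i) → ℚΣ.sum f ≤ ℚΣ.sum g
ℚΣ-mono-≤ {zero}  f≤g = ℚP.≤-refl
ℚΣ-mono-≤ {suc m} f≤g = ℚP.+-mono-≤ (f≤g F.zero) (ℚΣ-mono-≤ (f≤g ∘ F.suc))

ℚΣ-mono-< : ∀ {m} {f g : Fin (suc m) → ℚ} → (∀ i → f i < g i) → ℚΣ.sum f < ℚΣ.sum g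
ℚΣ-mono-< f<g = ℚP.+-mono-<-≤ (f<g F.zero) (ℚΣ-mono-≤ (ℚP.<⇒≤ ∘ f<g ∘ F.suc))

averaging : ∀ {m} (f g : Fin m → ℚ) → Fin m → ℚΣ.sum f ≤ ℚΣ.sum g → ∃ λ i → f i ≤ g i
averaging {suc m} f g _ ∑f≤∑g with any? (λ i → f i ℚP.≤? g i)
... | yes found = found
... | no  none  = ⊥-elim (ℚP.<-irrefl refl (ℚP.<-≤-trans ∑g<∑f ∑f≤∑g))
  where
  ∑g<∑f : ℚΣ.sum g < ℚΣ.sum f
  ∑g<∑f = ℚΣ-mono-< (λ i → ℚP.≰⇒> (λ f≤g → none (i , f≤g)))

chosen : ∀ {m} {A : Fin m → Set} → Dec (∃ A) → Maybe (Fin m)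
chosen (yes (i , _)) = just i
chosen (no  _)       = nothing

isHome : ∀ {m} → Maybe (Fin m) → Fin m → Bool
isHome nothing  i = false
isHome (just c) i = ⌊ c ≟ i ⌋

misplaced : ∀ {m} → Fin m → Maybe (Fin m) → Bool
misplaced p nothing  = false
misplaced p (just c) = not ⌊ p ≟ c ⌋

∑-xor-bound : ∀ m (p : Fin m) (h : Maybe (Fin m)) →
              ∑[ i < m ] 𝟙 (⌊ p ≟ i ⌋ xor isHome h i)
                ℕ.≤ 𝟙 (is-nothing h) ℕ.+ (𝟙 (misplaced p h) ℕ.+ 𝟙 (misplaced p h))
∑-xor-bound m p nothing =
  ℕP.≤-reflexive (trans (sum-cong-≗ {m} (λ i → cong 𝟙 (xor-identityʳ ⌊ p ≟ i ⌋))) (∑-≟ m p))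
∑-xor-bound m p (just c) with p ≟ c
... | yes refl = ℕP.≤-reflexive (trans (sum-cong-≗ {m} (λ i → cong 𝟙 (xor-same ⌊ p ≟ i ⌋)))
                                        (sum-replicate-zero m))
... | no  _    = begin
  ∑[ i < m ] 𝟙 (⌊ p ≟ i ⌋ xor ⌊ c ≟ i ⌋)                 ≤⟨ ∑-mono-≤ (λ i → 𝟙-xor ⌊ p ≟ i ⌋ ⌊ c ≟ i ⌋) ⟩
  ∑[ i < m ] (𝟙 ⌊ p ≟ i ⌋ ℕ.+ 𝟙 ⌊ c ≟ i ⌋)                ≡⟨ ∑-distrib-+ (λ i → 𝟙 ⌊ p ≟ i ⌋) (λ i → 𝟙 ⌊ c ≟ i ⌋) ⟩
  ∑[ i < m ] 𝟙 ⌊ p ≟ i ⌋ ℕ.+ ∑[ i < m ] 𝟙 ⌊ c ≟ i ⌋       ≡⟨ cong₂ ℕ._+_ (∑-≟ m p) (∑-≟ m c) ⟩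
  2                                                      ∎
  where
  open ℕP.≤-Reasoning
  𝟙-xor : ∀ a b → 𝟙 (a xor b) ℕ.≤ 𝟙 a ℕ.+ 𝟙 b
  𝟙-xor true  true  = ℕ.z≤n
  𝟙-xor true  false = ℕP.≤-refl
  𝟙-xor false b     = ℕP.≤-refl

module Construction {n} (𝒫 𝒬 : Partition n) (δ : ℚ) where

  home : Fin (k 𝒬) → Maybe (Fin (k 𝒫))
  home j = chosen (block 𝒬 j ∈[ δ ]? 𝒫)

  J : Fin (k 𝒫) → Subset (k 𝒬)
  J i = tabulate (λ j → isHome (home j) i)

  symdiff : Fin (k 𝒫) → ℕ
  symdiff i = ∣ block 𝒫 i △ unionOf 𝒬 (J i) ∣

  three-δ : ℚ
  three-δ = (+ 3) / 1 * δ

  ∣P△U∣-as-∑ : ∀ i → symdiff i ≡ ∑[ x < n ] 𝟙 (⌊ label 𝒫 x ≟ i ⌋ xor isHome (home (label 𝒬 x)) i)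
  ∣P△U∣-as-∑ i = trans (∣∣-as-∑ (block 𝒫 i △ unionOf 𝒬 (J i))) (sum-cong-≗ {n} (λ x → cong 𝟙 (begin
    lookup (block 𝒫 i △ unionOf 𝒬 (J i)) x                   ≡⟨ lookup-△ (block 𝒫 i) (unionOf 𝒬 (J i)) x ⟩
    lookup (block 𝒫 i) x xor lookup (unionOf 𝒬 (J i)) x     ≡⟨ cong₂ _xor_ (lookup∘tabulate _ x) (in-U x) ⟩
    ⌊ label 𝒫 x ≟ i ⌋ xor isHome (home (label 𝒬 x)) i        ∎)))
    where
    open ≡-Reasoning
    in-U : ∀ x → lookup (unionOf 𝒬 (J i)) x ≡ isHome (home (label 𝒬 x)) i
    in-U x = trans (lookup∘tabulate _ x) (lookup∘tabulate _ (label 𝒬 x))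

  unassigned : ℕ
  unassigned = ∑[ x < n ] 𝟙 (is-nothing (home (label 𝒬 x)))

  strays : ℕ
  strays = ∑[ x < n ] 𝟙 (misplaced (label 𝒫 x) (home (label 𝒬 x)))

  ∑-symdiff-bound : ∑[ i < k 𝒫 ] symdiff i ℕ.≤ unassigned ℕ.+ (strays ℕ.+ strays)
  ∑-symdiff-bound = begin
    ∑[ i < k 𝒫 ] symdiff i                                         ≡⟨ sum-cong-≗ {k 𝒫} ∣P△U∣-as-∑ ⟩
    ∑[ i < k 𝒫 ] ∑[ x < n ] 𝟙 (⌊ lP x ≟ i ⌋ xor isHome (hQ x) i)  ≡⟨ ∑-comm (λ i x → 𝟙 (⌊ lP x ≟ i ⌋ xor isHome (hQ x) i)) ⟩
    ∑[ x < n ] ∑[ i < k 𝒫 ] 𝟙 (⌊ lP x ≟ i ⌋ xor isHome (hQ x) i)  ≤⟨ ∑-mono-≤ (λ x → ∑-xor-bound (k 𝒫) (lP x) (hQ x)) ⟩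
    ∑[ x < n ] (unassigned? x ℕ.+ (stray? x ℕ.+ stray? x))        ≡⟨ ∑-distrib-+ unassigned? (λ x → stray? x ℕ.+ stray? x) ⟩
    unassigned ℕ.+ ∑[ x < n ] (stray? x ℕ.+ stray? x)             ≡⟨ cong (unassigned ℕ.+_) (∑-distrib-+ stray? stray?) ⟩
    unassigned ℕ.+ (strays ℕ.+ strays)                            ∎
    where
    open ℕP.≤-Reasoning
    lP = label 𝒫
    hQ = λ x → home (label 𝒬 x)
    unassigned? stray? : Fin n → ℕ
    unassigned? x = 𝟙 (is-nothing (hQ x))
    stray? x = 𝟙 (misplaced (lP x) (hQ x))

  unassigned≡badMass : unassigned ≡ badMass 𝒬 δ 𝒫
  unassigned≡badMass = begin
    unassigned
      ≡⟨ sym (∑-fibres (label 𝒬) (λ j _ → is-nothing (home j))) ⟩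
    ∑[ j < k 𝒬 ] ∑[ x < n ] 𝟙 (⌊ label 𝒬 x ≟ j ⌋ ∧ is-nothing (home j))
      ≡⟨ sum-cong-≗ {k 𝒬} (λ j → in-block j (block 𝒬 j ∈[ δ ]? 𝒫)) ⟩
    ∑[ j < k 𝒬 ] badSize (block 𝒬 j) δ 𝒫 (block 𝒬 j ∈[ δ ]? 𝒫)
      ≡⟨ sym (badMass-as-∑ 𝒬 𝒫 δ) ⟩
    badMass 𝒬 δ 𝒫
      ∎
    where
    open ≡-Reasoning
    in-block : ∀ j (d : Dec (block 𝒬 j ∈[ δ ] 𝒫)) →
               ∑[ x < n ] 𝟙 (⌊ label 𝒬 x ≟ j ⌋ ∧ is-nothing (chosen d)) ≡ badSize (block 𝒬 j) δ 𝒫 d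
    in-block j (yes _) = ∑-block-∧ 𝒬 j false
    in-block j (no  _) = trans (∑-block-∧ 𝒬 j true) (ℕP.*-identityˡ _)

  -- Each assigned block Q_j loses at most δ|Q_j| elements to strays, so strays ≤ δn.
  strays-bound : 0ℚ ≤ δ → ℕ→ℚ strays ≤ δ * ℕ→ℚ n
  strays-bound 0≤δ = begin
    ℕ→ℚ strays                               ≡⟨ cong ℕ→ℚ (sym (∑-fibres (label 𝒬) stray-of)) ⟩
    ℕ→ℚ (∑[ j < k 𝒬 ] in-block j)            ≡⟨ ℕ→ℚ-∑ in-block ⟩
    ℚΣ.sum (λ j → ℕ→ℚ (in-block j))          ≤⟨ ℚΣ-mono-≤ (λ j → in-block-bound j (block 𝒬 j ∈[ δ ]? 𝒫)) ⟩
    ℚΣ.sum (λ j → δ * ℕ→ℚ ∣ block 𝒬 j ∣)     ≡⟨ sym (ℚΣ.*-distribˡ-sum δ (λ j → ℕ→ℚ ∣ block 𝒬 j ∣)) ⟩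
    δ * ℚΣ.sum (λ j → ℕ→ℚ ∣ block 𝒬 j ∣)     ≡⟨ cong (δ *_) (sym (ℕ→ℚ-∑ (λ j → ∣ block 𝒬 j ∣))) ⟩
    δ * ℕ→ℚ (∑[ j < k 𝒬 ] ∣ block 𝒬 j ∣)     ≡⟨ cong (λ m → δ * ℕ→ℚ m) (∑-block-sizes 𝒬) ⟩
    δ * ℕ→ℚ n                                ∎
    where
    open ℚP.≤-Reasoning
    stray-of : Fin (k 𝒬) → Fin n → Bool
    stray-of j x = misplaced (label 𝒫 x) (home j)
    in-block : Fin (k 𝒬) → ℕ
    in-block j = ∑[ x < n ] 𝟙 (⌊ label 𝒬 x ≟ j ⌋ ∧ stray-of j x)
    in-block-bound : ∀ j (d : Dec (block 𝒬 j ∈[ δ ] 𝒫)) →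
      ℕ→ℚ (∑[ x < n ] 𝟙 (⌊ label 𝒬 x ≟ j ⌋ ∧ misplaced (label 𝒫 x) (chosen d))) ≤ δ * ℕ→ℚ ∣ block 𝒬 j ∣
    in-block-bound j (yes (c , Q⊆P)) = ℚP.≤-trans (ℚP.≤-reflexive (cong ℕ→ℚ (sym (∣Q─P∣-as-∑ 𝒬 𝒫 j c)))) Q⊆P
    in-block-bound j (no  _)         = subst (_≤ δ * ℕ→ℚ ∣ block 𝒬 j ∣) (cong ℕ→ℚ (sym (∑-block-∧ 𝒬 j false)))
                                             (*-nonNeg 0≤δ (0≤ℕ→ℚ ∣ block 𝒬 j ∣))

  ∑-symdiff-≤ : 0ℚ ≤ δ → 𝒬 ≺[ δ ] 𝒫 →
                ℚΣ.sum (λ i → ℕ→ℚ (symdiff i)) ≤ ℚΣ.sum (λ i → three-δ * ℕ→ℚ ∣ block 𝒫 i ∣)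
  ∑-symdiff-≤ 0≤δ 𝒬≺𝒫 = begin
    ℚΣ.sum (λ i → ℕ→ℚ (symdiff i))                ≡⟨ sym (ℕ→ℚ-∑ symdiff) ⟩
    ℕ→ℚ (∑[ i < k 𝒫 ] symdiff i)                  ≤⟨ ℕ→ℚ-mono ∑-symdiff-bound ⟩
    ℕ→ℚ (unassigned ℕ.+ (strays ℕ.+ strays))      ≡⟨ ℕ→ℚ-+ unassigned (strays ℕ.+ strays) ⟩
    ℕ→ℚ unassigned + ℕ→ℚ (strays ℕ.+ strays)      ≡⟨ cong (λ s → ℕ→ℚ unassigned + s) (ℕ→ℚ-+ strays strays) ⟩
    ℕ→ℚ unassigned + (ℕ→ℚ strays + ℕ→ℚ strays)
      ≤⟨ ℚP.+-mono-≤ unassigned-bound (ℚP.+-mono-≤ (strays-bound 0≤δ) (strays-bound 0≤δ)) ⟩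
    δn + (δn + δn)                                ≡⟨ sym (thrice δ (ℕ→ℚ n)) ⟩
    three-δ * ℕ→ℚ n                               ≡⟨ cong (λ m → three-δ * ℕ→ℚ m) (sym (∑-block-sizes 𝒫)) ⟩
    three-δ * ℕ→ℚ (∑[ i < k 𝒫 ] ∣ block 𝒫 i ∣)    ≡⟨ cong (three-δ *_) (ℕ→ℚ-∑ (λ i → ∣ block 𝒫 i ∣)) ⟩
    three-δ * ℚΣ.sum (λ i → ℕ→ℚ ∣ block 𝒫 i ∣)    ≡⟨ ℚΣ.*-distribˡ-sum three-δ (λ i → ℕ→ℚ ∣ block 𝒫 i ∣) ⟩
    ℚΣ.sum (λ i → three-δ * ℕ→ℚ ∣ block 𝒫 i ∣)    ∎
    where
    open ℚP.≤-Reasoning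
    δn = δ * ℕ→ℚ n
    unassigned-bound : ℕ→ℚ unassigned ≤ δn
    unassigned-bound = subst (λ m → ℕ→ℚ m ≤ δn) (sym unassigned≡badMass) 𝒬≺𝒫

claim6 : (n : ℕ) → n ≥ 1 → (𝒫 𝒬 : Partition n) → (δ : ℚ) →
    𝒬 ≺[ δ ] 𝒫 →
    ∃₂ λ (i : Fin (k 𝒫)) (J : Subset (k 𝒬)) →
    ℕ→ℚ ∣ block 𝒫 i △ unionOf 𝒬 J ∣ ≤ ((+ 3) / 1) * δ * ℕ→ℚ ∣ block 𝒫 i ∣
claim6 n n≥1 𝒫 𝒬 δ 𝒬≺𝒫 =
  let i , close = averaging _ _ some-block (∑-symdiff-≤ 0≤δ 𝒬≺𝒫) in i , J i , close
  where
  open Construction 𝒫 𝒬 δ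
  some-block : Fin (k 𝒫)
  some-block = label 𝒫 (F.fromℕ< n≥1)
  -- … and the hypothesis 0 ≤ badMass ≤ δn with n > 0 forces δ ≥ 0.
  0≤δ : 0ℚ ≤ δ
  0≤δ = nonNeg-factor (0≤ℕ→ℚ (badMass 𝒬 δ 𝒫)) 𝒬≺𝒫 (ℕ→ℚ-pos n≥1)
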